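{- Let $P$ be a packaged arrow presentation and let $e\neq g$ be edges of $P$. Let $\circ_1,\circ_2$ each be any of the five operations deletion $\setminus$, contraction $/$, Penrose-contraction $\dagger$, merge-deletion $\setminus_m$, merge-contraction $/_m$. Then $(P\circ_1 e)\circ_2 g=(P\circ_2 g)\circ_1 e$.
   Context: An arrow presentation $A$ consists of a finite set $V(A)$ of disjoint circles (the vertices), a finite set of pairwise disjoint arrows (directed arcs) on the circles, and a finite set $E(A)$ of labels (the edges) such that every arrow carries one label and every label is carried by exactly two arrows (constituting that edge). An arrow along a circle from $p$ to $q$ is written $\overrightarrow{pq}$. Arrow presentations are considered up to equivalence (diffeomorphism of circles sending arrows to arrows, reversing both arrows of some edges, relabelling edges bijectively). Boundary components: for every edge $e$ with arrows $\overrightarrow{p_1p_2},\overrightarrow{q_1q_2}$, remove the arrows with the interiors of their arcs and add a curve joining $q_2$ to $p_1$ and one joining $p_2$ to $q_1$; the resulting closed curves form $B(A)$. For an edge $e$ with arrows $\overrightarrow{p_1p_2},\overrightarrow{q_1q_2}$: $A\setminus e$ removes the two arrows (not their arcs) and $e$; $A/e$ removes the arrows with the interiors of their arcs, identifies $p_1$ with $q_2$ and $p_2$ with $q_1$, and removes $e$; $A\dagger e$ does the same but identifies $p_1$ with $q_1$ and $p_2$ with $q_2$. A packaged arrow presentation is $P=(A,\mathcal V,\mathcal B)$ with $\mathcal V$ a partition of $V(A)$, $\mathcal B$ a partition of $B(A)$; $[v]$ is the block containing $v$. For an edge $e$ with incident vertices $u,v$ and incident boundary components $a,b$ (possibly equal):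 vertices of $A$ and $A\setminus e$ are identified; vertices of $A$ other than $u,v$ are identified with vertices of $A/e$ (resp. $A\dagger e$) and the rest form the set $T$ of created vertices; boundary components of $A$ and $A/e$ are identified; boundary components of $A$ other than $a,b$ are identified with those of $A\setminus e$ (resp. $A\dagger e$) and the rest form the set $S$ of created boundary components. Put $\mathcal V'=(\mathcal V-\{[u],[v]\})\cup\{[u]\cup[v]\}$, $\mathcal B'=(\mathcal B-\{[a],[b]\})\cup\{[a]\cup[b]\cup S-\{a,b\}\}$ ($S$ from deletion), $\mathcal V''=(\mathcal V-\{[u],[v]\})\cup\{[u]\cup[v]\cup T-\{u,v\}\}$ ($T$ from contraction), $\mathcal B''=(\mathcal B-\{[a],[b]\})\cup\{[a]\cup[b]\}$, and $\mathcal V''',\mathcal B'''$ defined like $\mathcal V'',\mathcal B'$ with $T,S$ created by the Penrose-contraction. Then $P\setminus e=(A\setminus e,\mathcal V,\mathcal B')$, $P\setminus_m e=(A\setminus e,\mathcal V',\mathcal B')$, $P/e=(A/e,\mathcal V'',\mathcal B)$, $P/_m e=(A/e,\mathcal V'',\mathcal B'')$, $P\dagger e=(A\dagger e,\mathcal V''',\mathcal B''')$. -}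

module Defs where

open import Data.Bool using (Bool; true; false; _xor_)
open import Data.Fin using (Fin)
open import Data.Fin.Patterns using (0F; 1F; 2F; 3F)
open import Data.Sum using (_⊎_; inj₁; inj₂)
open import Data.Product using (Σ; _×_; _,_)
open import Data.List using (List)
open import Data.List.Membership.Propositional using (_∈_)
open import Relation.Binary.PropositionalEquality using (_≡_; _≢_; refl)
open import Relation.Binary.Definitions using (DecidableEquality)
open import Relation.Binary.Structures using (IsEquivalence)
open import Relation.Binary.Construct.Closure.Equivalence using (EqClosure)
open import Relation.Nullary using (yes; no)
open import Function using (_⇔_)
open import Function.Bundles using (_↔_; Inverse)

-- The circles of an arrow presentation are cut, at the arrow endpoints,
-- into arrows and "atoms" (the arcs of the circles not covered by
-- arrows; an arrow-free circle is a single atom whose two ends are glued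
-- together).  Every atom has two ends (Atom × Bool); every edge e has
-- four arrow endpoints ("ports"):
--   0 = p₁ (tail of first arrow),  1 = p₂ (head of first arrow),
--   2 = q₁ (tail of second arrow), 3 = q₂ (head of second arrow).
-- 'glue' says which end meets which end on the circles.
-- With this encoding  i ⊕ 1  is the other end of the same arrow,
--   i ⊕ 3  is the boundary-connector partner (q₂–p₁, p₂–q₁), and
--   i ⊕ 2  is the Penrose partner (p₁–q₁, p₂–q₂).

Port : Set
Port = Fin 4

_⊕_ : Port → Port → Port
i ⊕ 0F = i
0F ⊕ 1F = 1F
1F ⊕ 1F = 0F
2F ⊕ 1F = 3F
3F ⊕ 1F = 2F
0F ⊕ 2F = 2F
1F ⊕ 2F = 3F
2F ⊕ 2F = 0F
3F ⊕ 2F = 1F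
0F ⊕ 3F = 3F
1F ⊕ 3F = 2F
2F ⊕ 3F = 1F
3F ⊕ 3F = 0F

End : Set → Set → Set
End C E = (C × Bool) ⊎ (E × Port)

record ArrowPres : Set₁ where
  field
    Atom  : Set
    Edge  : Set
    _≟E_  : DecidableEquality Edge
    glue  : End Atom Edge → End Atom Edge
open ArrowPres public

Finite : Set → Set
Finite X = Σ (List X) λ l → ∀ x → x ∈ l

-- the raw data really describes an arrow presentation:
-- finitely many atoms/edges, gluing is a fixed-point-free involution,
-- arrows are pairwise disjoint (an arrow endpoint is glued to an atom).
record WellFormed (A : ArrowPres) : Set where
  field
    atoms-finite : Finite (Atom A)
    edges-finite : Finite (Edge A)
    glue-invol   : ∀ x → glue A (glue A x) ≡ x
    glue-nofix   : ∀ x → glue A x ≢ x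
    glue-arc     : ∀ e i → Σ (Atom A × Bool) λ a → glue A (inj₂ (e , i)) ≡ inj₁ a

module _ (A : ArrowPres) where
  -- atoms c, c' are adjacent when walking along the circles, where an
  -- arrow endpoint i of an edge is crossed to the endpoint i ⊕ m.
  Adj : Port → Atom A → Atom A → Set
  Adj m c c' = Σ Bool λ b → Σ Bool λ b' →
      (glue A (inj₁ (c , b)) ≡ inj₁ (c' , b'))
    ⊎ Σ (Edge A) λ e → Σ Port λ i →
        (glue A (inj₁ (c , b)) ≡ inj₂ (e , i)) × (glue A (inj₂ (e , i ⊕ m)) ≡ inj₁ (c' , b'))

  -- same vertex (circle): cross arrows along their arcs
  VRel : Atom A → Atom A → Set
  VRel = EqClosure (Adj 1F)

  -- same boundary component: cross via connectors q₂–p₁, p₂–q₁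
  BRel : Atom A → Atom A → Set
  BRel = EqClosure (Adj 3F)

  AtPort : Edge A → Port → Atom A → Set
  AtPort e i c = Σ Bool λ b → glue A (inj₂ (e , i)) ≡ inj₁ (c , b)

record Rem (E : Set) (e : E) : Set where
  constructor rem
  field
    elt   : E
    .ne   : elt ≢ e
open Rem public

module _ (A : ArrowPres) (e : Edge A) (m : Port) where
  private
    C = Atom A
    E = Edge A
    E' = Rem E e
    _≟_ = _≟E_ A

  ≟Rem : DecidableEquality E'
  ≟Rem (rem g _) (rem h _) with g ≟ h
  ... | yes refl = yes refl
  ... | no g≢h = no λ { refl → g≢h refl }

  lift : End C E' → End C E
  lift (inj₁ a) = inj₁ a
  lift (inj₂ (rem g _ , i)) = inj₂ (g , i)

  shrink : End C E → End C E' → End C E'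
  shrink (inj₁ a) d = inj₁ a
  shrink (inj₂ (g , i)) d with g ≟ e
  ... | yes _ = d
  ... | no g≢e = inj₂ (rem g g≢e , i)

  -- an end glued to port i of e becomes glued to whatever was glued
  -- to port i ⊕ m of e
  -- (m = 1: deletion, arcs of the arrows kept;
  --  m = 3: contraction, p₁~q₂ and p₂~q₁ identified;
  --  m = 2: Penrose-contraction, p₁~q₁ and p₂~q₂ identified)
  glue' : End C E' → End C E'
  glue' x with glue A (lift x)
  ... | inj₁ a = inj₁ a
  ... | inj₂ (g , i) with g ≟ e
  ...    | no g≢e = inj₂ (rem g g≢e , i)
  ...    | yes _  = shrink (glue A (inj₂ (e , i ⊕ m))) x

  removeEdge : ArrowPres
  removeEdge = record { Atom = C ; Edge = E' ; _≟E_ = ≟Rem ; glue = glue' }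

_∖ₐ_ : (A : ArrowPres) → Edge A → ArrowPres
A ∖ₐ e = removeEdge A e 1F

_/ₐ_ : (A : ArrowPres) → Edge A → ArrowPres
A /ₐ e = removeEdge A e 3F

_†ₐ_ : (A : ArrowPres) → Edge A → ArrowPres
A †ₐ e = removeEdge A e 2F

-- Vertices and boundary components are identified with classes of
-- atoms (VRel / BRel); a partition of V(A) (resp. B(A)) is an
-- equivalence relation on atoms that is a union of VRel- (BRel-) classes.
-- Atoms persist through all operations, which realises the paper's
-- identifications of vertices/boundary components of A with those of
-- A∖e, A/e, A†e.

record Packaged : Set₁ where
  field
    arr : ArrowPres
    𝒱   : Atom arr → Atom arr → Set
    ℬ   : Atom arr → Atom arr → Set
open Packaged public

record WellFormedP (P : Packaged) : Set where
  field
    wf     : WellFormed (arr P)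
    𝒱-eq   : IsEquivalence (𝒱 P)
    ℬ-eq   : IsEquivalence (ℬ P)
    𝒱-part : ∀ {c c'} → VRel (arr P) c c' → 𝒱 P c c'
    ℬ-part : ∀ {c c'} → BRel (arr P) c c' → ℬ P c c'

merge : {C : Set} → (C → C → Set) → (C → Set) → C → C → Set
merge R Blk x y = R x y ⊎ (Blk x × Blk y)

module _ (P : Packaged) (e : Edge (arr P)) where
  private
    A = arr P
  InBlockAt : (Atom A → Atom A → Set) → Port → Atom A → Set
  InBlockAt R i x = Σ (Atom A) λ c → AtPort A e i c × R x c

  -- incident vertices u (port p₁) and v (port q₁) of e,
  -- incident boundary components a (connector q₂–p₁) and b (connector p₂–q₁)
  In[u] In[v] In[a] In[b] : Atom A → Set
  In[u] = InBlockAt (𝒱 P) 0F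
  In[v] = InBlockAt (𝒱 P) 2F
  In[a] = InBlockAt (ℬ P) 0F
  In[b] = InBlockAt (ℬ P) 1F

  -- atoms of the created vertices T (contraction / Penrose-contraction):
  -- the vertices of A/e, A†e not identified with vertices of A other than
  -- u, v, i.e. made of the atoms of u and v.
  InT : Atom A → Set
  InT x = InBlockAt (VRel A) 0F x ⊎ InBlockAt (VRel A) 2F x
  -- atoms of the created boundary components S (deletion /
  -- Penrose-contraction): made of the atoms of a and b.
  InS : Atom A → Set
  InS x = InBlockAt (BRel A) 0F x ⊎ InBlockAt (BRel A) 1F x

  𝒱′ 𝒱″ ℬ′ ℬ″ : Atom A → Atom A → Set
  𝒱′ = merge (𝒱 P) (λ x → In[u] x ⊎ In[v] x)
  𝒱″ = merge (𝒱 P) (λ x → In[u] x ⊎ In[v] x ⊎ InT x)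
  ℬ′ = merge (ℬ P) (λ x → In[a] x ⊎ In[b] x ⊎ InS x)
  ℬ″ = merge (ℬ P) (λ x → In[a] x ⊎ In[b] x)

  -- 𝒱‴, ℬ‴ are defined like 𝒱″, ℬ′ with T, S created by A†e; those
  -- consist of the same atoms as above.
  𝒱‴ ℬ‴ : Atom A → Atom A → Set
  𝒱‴ = 𝒱″
  ℬ‴ = ℬ′

  del mdel con mcon pen : Packaged
  del  = record { arr = A ∖ₐ e ; 𝒱 = 𝒱 P ; ℬ = ℬ′ }
  mdel = record { arr = A ∖ₐ e ; 𝒱 = 𝒱′ ; ℬ = ℬ′ }
  con  = record { arr = A /ₐ e ; 𝒱 = 𝒱″ ; ℬ = ℬ P }
  mcon = record { arr = A /ₐ e ; 𝒱 = 𝒱″ ; ℬ = ℬ″ }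
  pen  = record { arr = A †ₐ e ; 𝒱 = 𝒱‴ ; ℬ = ℬ‴ }

data Op : Set where
  ∖op ∖mop /op /mop †op : Op

opPort : Op → Port
opPort ∖op  = 1F
opPort ∖mop = 1F
opPort /op  = 3F
opPort /mop = 3F
opPort †op  = 2F

-- P ⟪ o ⟫ e : apply operation o to edge e.  Defined as a record so that
-- the edge type of the result is definitionally  Rem (Edge (arr P)) e.
_⟪_⟫_ : (P : Packaged) → Op → Edge (arr P) → Packaged
P ⟪ o ⟫ e = record { arr = removeEdge (arr P) e (opPort o) ; 𝒱 = V o ; ℬ = B o }
  where
    V B : (o : Op) → Atom (arr P) → Atom (arr P) → Set
    V ∖op  = 𝒱 (del P e)
    V ∖mop = 𝒱 (mdel P e)
    V /op  = 𝒱 (con P e)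
    V /mop = 𝒱 (mcon P e)
    V †op  = 𝒱 (pen P e)
    B ∖op  = ℬ (del P e)
    B ∖mop = ℬ (mdel P e)
    B /op  = ℬ (con P e)
    B /mop = ℬ (mcon P e)
    B †op  = ℬ (pen P e)

-- Equivalence of packaged arrow presentations: a homeomorphism of the
-- circles sending arrows to arrows (possibly reversing atoms), combined
-- with a bijective relabelling of edges and, per edge, an element of the
-- Klein group on ports (reverse both arrows / swap the two arrows),
-- which carries the vertex and boundary partitions onto each other.

mapEnd : {C C' E E' : Set} → (C → C') → (E → E') → (C → Bool) → (E → Port)
  → End C E → End C' E'
mapEnd ψ φ f t (inj₁ (c , b)) = inj₁ (ψ c , b xor f c)
mapEnd ψ φ f t (inj₂ (g , i)) = inj₂ (φ g , i ⊕ t g)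

record _≅_ (P Q : Packaged) : Set where
  field
    atomIso   : Atom (arr P) ↔ Atom (arr Q)
    edgeIso   : Edge (arr P) ↔ Edge (arr Q)
    atomFlip  : Atom (arr P) → Bool
    edgeTwist : Edge (arr P) → Port
    glue-comm : ∀ x → mapEnd (Inverse.to atomIso) (Inverse.to edgeIso) atomFlip edgeTwist (glue (arr P) x)
                      ≡ glue (arr Q) (mapEnd (Inverse.to atomIso) (Inverse.to edgeIso) atomFlip edgeTwist x)
    𝒱-pres    : ∀ c c' → 𝒱 P c c' ⇔ 𝒱 Q (Inverse.to atomIso c) (Inverse.to atomIso c')
    ℬ-pres    : ∀ c c' → ℬ P c c' ⇔ ℬ Q (Inverse.to atomIso c) (Inverse.to atomIso c')

{-# OPTIONS --safe #-}

-- Removing an edge e whose two arrows are reconnected by the port map i ↦ i ⊕ m amounts to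
-- rerouting every end glued to port i of e to the end glued to port i ⊕ m of e.  Reroutings
-- along distinct edges commute, so both orders of removal give the same gluing, with the atoms
-- fixed and the remaining edges relabelled.
-- On the vertex and the boundary partition each operation either does nothing or merges all
-- blocks meeting the atoms at the ports of e that lie on its incident vertices (boundary
-- components).  The blocks of the created vertices T and boundary components S add nothing,
-- because the partitions are coarser than the actual vertices and boundary components, and this
-- coarseness survives each operation.  Two such merges commute.

module Submission where

open import Defs
open import Data.Bool using (Bool; true; false)
open import Data.Bool.Properties using (xor-identityʳ)
open import Data.Fin.Patterns using (0F; 1F; 2F; 3F)
open import Data.Sum as Sum using (_⊎_; inj₁; inj₂)
open import Data.Product using (Σ; _×_; _,_)
open import Level using (0ℓ)
open import Data.Empty using (⊥-elim)
open import Function using (id; _∘_)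
open import Function.Bundles using (_↔_; mk↔ₛ′; mk⇔)
open import Function.Construct.Identity using (↔-id)
open import Relation.Binary.PropositionalEquality using (_≡_; _≢_; ≢-sym; refl; sym; trans; cong; subst; module ≡-Reasoning)
open import Relation.Nullary using (yes; no)
open import Relation.Binary.Core using (Rel; _⇒_)
open import Relation.Binary.Structures using (IsEquivalence)
open import Relation.Binary.Construct.Closure.Equivalence using (EqClosure; return; fold)
open import Relation.Unary using (Pred; _⊆_)

module _ {C : Set} where

  Meets : Rel C 0ℓ → Pred C 0ℓ → Pred C 0ℓ
  Meets R S x = Σ C λ c → S c × R x c

  mergeIf : Bool → Rel C 0ℓ → Pred C 0ℓ → Rel C 0ℓ
  mergeIf false R S = R
  mergeIf true  R S = merge R (Meets R S)

  merge-mono : ∀ (R : Rel C 0ℓ) {B B′ : Pred C 0ℓ} → B ⊆ B′ → merge R B ⇒ merge R B′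
  merge-mono R B⊆B′ (inj₁ r)        = inj₁ r
  merge-mono R B⊆B′ (inj₂ (bx , by)) = inj₂ (B⊆B′ bx , B⊆B′ by)

  Meets-mono : ∀ {R R′ : Rel C 0ℓ} {S S′ : Pred C 0ℓ} → R ⇒ R′ → S ⊆ S′ → Meets R S ⊆ Meets R′ S′
  Meets-mono R⇒R′ S⊆S′ {x} (c , s , xc) = c , S⊆S′ s , R⇒R′ {x} {c} xc

  module _ {R : Rel C 0ℓ} {S : Pred C 0ℓ} where

    mergeIf-⊇ : ∀ b → R ⇒ mergeIf b R S
    mergeIf-⊇ false r = r
    mergeIf-⊇ true  r = inj₁ r

    mergeIf-merges : ∀ {b x y} → b ≡ true → Meets R S x → Meets R S y → mergeIf b R S x y
    mergeIf-merges refl mx my = inj₂ (mx , my)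

    mergeIf-isEquivalence : ∀ b → IsEquivalence R → IsEquivalence (mergeIf b R S)
    mergeIf-isEquivalence false isEq = isEq
    mergeIf-isEquivalence true  isEq = record
      { refl  = inj₁ R.refl
      ; sym   = λ { (inj₁ r) → inj₁ (R.sym r) ; (inj₂ (mx , my)) → inj₂ (my , mx) }
      ; trans = trans′
      }
      where
      module R = IsEquivalence isEq
      meets-resp : ∀ {x y} → R x y → Meets R S y → Meets R S x
      meets-resp xy (c , s , yc) = c , s , R.trans xy yc
      trans′ : ∀ {x y z} → merge R (Meets R S) x y → merge R (Meets R S) y z → merge R (Meets R S) x z
      trans′ (inj₁ xy)       (inj₁ yz)       = inj₁ (R.trans xy yz)
      trans′ (inj₁ xy)       (inj₂ (my , mz)) = inj₂ (meets-resp xy my , mz)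
      trans′ (inj₂ (mx , my)) (inj₁ yz)       = inj₂ (mx , meets-resp (R.sym yz) my)
      trans′ (inj₂ (mx , _))  (inj₂ (_ , mz)) = inj₂ (mx , mz)

  mergeIf-mono : ∀ b {R R′ : Rel C 0ℓ} {S S′ : Pred C 0ℓ} → R ⇒ R′ → S ⊆ S′ → mergeIf b R S ⇒ mergeIf b R′ S′
  mergeIf-mono false R⇒R′ S⊆S′ r                = R⇒R′ r
  mergeIf-mono true  R⇒R′ S⊆S′ (inj₁ r)        = inj₁ (R⇒R′ r)
  mergeIf-mono true {R} {R′} {S} {S′} R⇒R′ S⊆S′ (inj₂ (mx , my)) = inj₂ (meets mx , meets my)
    where
    meets : Meets R S ⊆ Meets R′ S′
    meets = Meets-mono {R} {R′} {S} {S′} R⇒R′ S⊆S′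

  mergeIf-comm : ∀ {R : Rel C 0ℓ} {S₁ S₂ : Pred C 0ℓ} → IsEquivalence R →
    ∀ b₁ b₂ → mergeIf b₂ (mergeIf b₁ R S₁) S₂ ⇒ mergeIf b₁ (mergeIf b₂ R S₂) S₁
  mergeIf-comm isEq b₁ false r = r
  mergeIf-comm isEq b₁ true (inj₁ r) = mergeIf-mono b₁ inj₁ id r
  -- x and y reach the points c, d of S₂ inside mergeIf b₁ R S₁, and c, d are merged on the right.
  mergeIf-comm {R} {S₁} {S₂} isEq b₁ true (inj₂ ((c , s , xc) , (d , s′ , yd))) =
    Q.trans (embed xc) (Q.trans (mergeIf-⊇ b₁ (inj₂ ((c , s , R.refl) , (d , s′ , R.refl)))) (Q.sym (embed yd)))
    where
    module R = IsEquivalence isEq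
    module Q = IsEquivalence (mergeIf-isEquivalence {S = S₁} b₁ (mergeIf-isEquivalence {S = S₂} true isEq))
    embed : mergeIf b₁ R S₁ ⇒ mergeIf b₁ (mergeIf true R S₂) S₁
    embed = mergeIf-mono b₁ inj₁ id

PortsOnAtoms : ArrowPres → Set
PortsOnAtoms A = ∀ e i → Σ (Atom A × Bool) λ a → glue A (inj₂ (e , i)) ≡ inj₁ a

rem-cong : {E : Set} {e h h′ : E} .{p : h ≢ e} .{p′ : h′ ≢ e} → h ≡ h′ → rem h p ≡ rem h′ p′
rem-cong refl = refl

Rem-swap : {E : Set} {e g : E} .(e≢g : e ≢ g) → Rem (Rem E e) (rem g (≢-sym e≢g)) → Rem (Rem E g) (rem e e≢g)
Rem-swap _ (rem (rem h h≢e) h≢g) = rem (rem h λ h≡g → h≢g (rem-cong h≡g)) λ h≡e → h≢e (cong elt h≡e)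

AdjAcross : (A : ArrowPres) → Edge A → Port → Atom A → Atom A → Set
AdjAcross A e m c c′ = Σ Bool λ b → Σ Bool λ b′ → Σ Port λ i →
  (glue A (inj₁ (c , b)) ≡ inj₂ (e , i)) × (glue A (inj₂ (e , i ⊕ m)) ≡ inj₁ (c′ , b′))

AdjAcross⇒Adj : ∀ {A e m c c′} → AdjAcross A e m c c′ → Adj A m c c′
AdjAcross⇒Adj {e = e} (b , b′ , i , into , out) = b , b′ , inj₂ (e , i , into , out)

module RemoveEdge (A : ArrowPres) (e : Edge A) (m : Port) where

  private
    A′ = removeEdge A e m

  reroute : End (Atom A) (Edge A) → End (Atom A) (Edge A)
  reroute (inj₁ a) = inj₁ a
  reroute (inj₂ (h , i)) with _≟E_ A h e
  ... | yes _ = glue A (inj₂ (e , i ⊕ m))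
  ... | no _  = inj₂ (h , i)

  reroute-self : ∀ i → reroute (inj₂ (e , i)) ≡ glue A (inj₂ (e , i ⊕ m))
  reroute-self i with _≟E_ A e e
  ... | yes _   = refl
  ... | no e≢e = ⊥-elim (e≢e refl)

  reroute-other : ∀ {h} i → h ≢ e → reroute (inj₂ (h , i)) ≡ inj₂ (h , i)
  reroute-other {h} i h≢e with _≟E_ A h e
  ... | yes h≡e = ⊥-elim (h≢e h≡e)
  ... | no _    = refl

  reroute-glue-port : PortsOnAtoms A → ∀ h i → reroute (glue A (inj₂ (h , i))) ≡ glue A (inj₂ (h , i))
  reroute-glue-port ports h i with ports h i
  ... | _ , eq rewrite eq = refl

  lift-injective : ∀ {x y} → lift A e m x ≡ lift A e m y → x ≡ y
  lift-injective {inj₁ _} {inj₁ _} refl = refl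
  lift-injective {inj₂ (rem _ _ , _)} {inj₂ (rem _ _ , _)} refl = refl

  lift-glue : PortsOnAtoms A → ∀ x → lift A e m (glue A′ x) ≡ reroute (glue A (lift A e m x))
  lift-glue ports x with glue A (lift A e m x)
  ... | inj₁ _ = refl
  ... | inj₂ (h , i) with _≟E_ A h e
  ...   | no _ = refl
  ...   | yes refl with ports e (i ⊕ m)
  ...     | _ , eq rewrite eq = refl

  lift-glue-port : PortsOnAtoms A → ∀ h′ j → lift A e m (glue A′ (inj₂ (h′ , j))) ≡ glue A (inj₂ (elt h′ , j))
  lift-glue-port ports h′ j = trans (lift-glue ports (inj₂ (h′ , j))) (reroute-glue-port ports (elt h′) j)

  removeEdge-portsOnAtoms : PortsOnAtoms A → PortsOnAtoms A′
  removeEdge-portsOnAtoms ports h′ j with ports (elt h′) j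
  ... | a , eq = a , lift-injective (trans (lift-glue-port ports h′ j) eq)

  AtPort-removeEdge⁺ : PortsOnAtoms A → ∀ {h′ j c} → AtPort A′ h′ j c → AtPort A (elt h′) j c
  AtPort-removeEdge⁺ ports {h′} {j} (b , eq) = b , trans (sym (lift-glue-port ports h′ j)) (cong (lift A e m) eq)

  AtPort-removeEdge⁻ : PortsOnAtoms A → ∀ {h′ j c} → AtPort A (elt h′) j c → AtPort A′ h′ j c
  AtPort-removeEdge⁻ ports {h′} {j} (b , eq) = b , lift-injective (trans (lift-glue-port ports h′ j) eq)

  reroute-atom⁻¹ : ∀ v {a} → reroute v ≡ inj₁ a
    → v ≡ inj₁ a ⊎ Σ Port λ i → v ≡ inj₂ (e , i) × glue A (inj₂ (e , i ⊕ m)) ≡ inj₁ a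
  reroute-atom⁻¹ (inj₁ _) refl = inj₁ refl
  reroute-atom⁻¹ (inj₂ (h , i)) eq with _≟E_ A h e | eq
  ... | yes refl | glued = inj₂ (i , refl , glued)
  ... | no _     | ()

  reroute-port⁻¹ : PortsOnAtoms A → ∀ v {h i} → reroute v ≡ inj₂ (h , i) → v ≡ inj₂ (h , i)
  reroute-port⁻¹ ports (inj₂ (h , i)) eq with _≟E_ A h e | eq
  ... | no _     | refl = refl
  ... | yes refl | glued with ports e (i ⊕ m)
  ...   | _ , onAtom with trans (sym onAtom) glued
  ...     | ()

  lift-glue-eq : PortsOnAtoms A → ∀ {x y} → glue A′ x ≡ y → reroute (glue A (lift A e m x)) ≡ lift A e m y
  lift-glue-eq ports {x} eq = trans (sym (lift-glue ports x)) (cong (lift A e m) eq)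

  Adj-removeEdge : PortsOnAtoms A → ∀ {m′ c c′} → Adj A′ m′ c c′ → Adj A m′ c c′ ⊎ AdjAcross A e m c c′
  Adj-removeEdge ports (b , b′ , inj₁ glued) with reroute-atom⁻¹ _ (lift-glue-eq ports glued)
  ... | inj₁ glued′              = inj₁ (b , b′ , inj₁ glued′)
  ... | inj₂ (i , into , out)    = inj₂ (b , b′ , i , into , out)
  Adj-removeEdge ports {m′} (b , b′ , inj₂ (h′ , i , into , out)) =
    inj₁ (b , b′ , inj₂ (elt h′ , i , reroute-port⁻¹ ports _ (lift-glue-eq ports into) ,
                         trans (sym (lift-glue-port ports h′ (i ⊕ m′))) (cong (lift A e m) out)))

open RemoveEdge

module _ (A : ArrowPres) (ports : PortsOnAtoms A) where

  lift-reroute : ∀ e m g′ m′ w → lift A e m (reroute (removeEdge A e m) g′ m′ w) ≡ reroute A (elt g′) m′ (lift A e m w)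
  lift-reroute e m g′ m′ (inj₁ _) = refl
  lift-reroute e m g′@(rem g _) m′ (inj₂ (rem h _ , i)) with _≟E_ A h g
  ... | yes refl = lift-glue-port A e m ports g′ (i ⊕ m′)
  ... | no _     = refl

  reroute-comm : ∀ {e g} → e ≢ g → ∀ m₁ m₂ v → reroute A g m₂ (reroute A e m₁ v) ≡ reroute A e m₁ (reroute A g m₂ v)
  reroute-comm e≢g m₁ m₂ (inj₁ _) = refl
  reroute-comm {e} {g} e≢g m₁ m₂ (inj₂ (h , i)) with _≟E_ A h e
  ... | yes refl = begin
    reroute A g m₂ (glue A (inj₂ (e , i ⊕ m₁)))  ≡⟨ reroute-glue-port A g m₂ ports e (i ⊕ m₁) ⟩
    glue A (inj₂ (e , i ⊕ m₁))                   ≡⟨ reroute-self A e m₁ i ⟨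
    reroute A e m₁ (inj₂ (e , i))                ≡⟨ cong (reroute A e m₁) (reroute-other A g m₂ i e≢g) ⟨
    reroute A e m₁ (reroute A g m₂ (inj₂ (e , i))) ∎
    where open ≡-Reasoning
  ... | no h≢e with _≟E_ A h g
  ...   | yes refl = sym (reroute-glue-port A e m₁ ports g (i ⊕ m₂))
  ...   | no _     = sym (reroute-other A e m₁ i h≢e)

module RemoveTwoEdges (A : ArrowPres) (e : Edge A) (m : Port) (g′ : Edge (removeEdge A e m)) (m′ : Port) where
  private
    A₁ = removeEdge A e m
    A₁₂ = removeEdge A₁ g′ m′

  lift² : End (Atom A) (Edge A₁₂) → End (Atom A) (Edge A)
  lift² x = lift A e m (lift A₁ g′ m′ x)

  lift²-injective : ∀ {x y} → lift² x ≡ lift² y → x ≡ y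
  lift²-injective eq = lift-injective A₁ g′ m′ (lift-injective A e m eq)

  lift²-glue : PortsOnAtoms A → ∀ x → lift² (glue A₁₂ x) ≡ reroute A (elt g′) m′ (reroute A e m (glue A (lift² x)))
  lift²-glue ports x = begin
    lift A e m (lift A₁ g′ m′ (glue A₁₂ x))
      ≡⟨ cong (lift A e m) (lift-glue A₁ g′ m′ (removeEdge-portsOnAtoms A e m ports) x) ⟩
    lift A e m (reroute A₁ g′ m′ (glue A₁ (lift A₁ g′ m′ x)))
      ≡⟨ lift-reroute A ports e m g′ m′ (glue A₁ (lift A₁ g′ m′ x)) ⟩
    reroute A (elt g′) m′ (lift A e m (glue A₁ (lift A₁ g′ m′ x)))
      ≡⟨ cong (reroute A (elt g′) m′) (lift-glue A e m ports (lift A₁ g′ m′ x)) ⟩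
    reroute A (elt g′) m′ (reroute A e m (glue A (lift² x))) ∎
    where open ≡-Reasoning

module _ (A : ArrowPres) {e g : Edge A} (e≢g : e ≢ g) (m₁ m₂ : Port) where
  private
    e₂ : Edge (removeEdge A g m₂)
    e₂ = rem e e≢g
    g₁ : Edge (removeEdge A e m₁)
    g₁ = rem g (≢-sym e≢g)
    A₁₂ = removeEdge (removeEdge A e m₁) g₁ m₂
    A₂₁ = removeEdge (removeEdge A g m₂) e₂ m₁
    module R₁₂ = RemoveTwoEdges A e m₁ g₁ m₂
    module R₂₁ = RemoveTwoEdges A g m₂ e₂ m₁

  swap-removed-edges : Edge A₁₂ ↔ Edge A₂₁
  swap-removed-edges = mk↔ₛ′ (Rem-swap e≢g) (Rem-swap (≢-sym e≢g)) (λ { (rem (rem _ _) _) → refl }) (λ { (rem (rem _ _) _) → refl })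

  relabel-removed-edges : End (Atom A) (Edge A₁₂) → End (Atom A) (Edge A₂₁)
  relabel-removed-edges = mapEnd id (Rem-swap e≢g) (λ _ → false) (λ _ → 0F)

  lift²-relabel : ∀ x → R₂₁.lift² (relabel-removed-edges x) ≡ R₁₂.lift² x
  lift²-relabel (inj₁ (c , b)) = cong (λ b′ → inj₁ (c , b′)) (xor-identityʳ b)
  lift²-relabel (inj₂ (rem (rem _ _) _ , _)) = refl

  removeEdge-comm : PortsOnAtoms A → ∀ x → relabel-removed-edges (glue A₁₂ x) ≡ glue A₂₁ (relabel-removed-edges x)
  removeEdge-comm ports x = R₂₁.lift²-injective (begin
    R₂₁.lift² (relabel-removed-edges (glue A₁₂ x))                    ≡⟨ lift²-relabel (glue A₁₂ x) ⟩
    R₁₂.lift² (glue A₁₂ x)                                             ≡⟨ R₁₂.lift²-glue ports x ⟩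
    reroute A g m₂ (reroute A e m₁ (glue A (R₁₂.lift² x)))             ≡⟨ reroute-comm A ports e≢g m₁ m₂ (glue A (R₁₂.lift² x)) ⟩
    reroute A e m₁ (reroute A g m₂ (glue A (R₁₂.lift² x)))             ≡⟨ cong (reroute A e m₁ ∘ reroute A g m₂ ∘ glue A) (lift²-relabel x) ⟨
    reroute A e m₁ (reroute A g m₂ (glue A (R₂₁.lift² (relabel-removed-edges x)))) ≡⟨ R₂₁.lift²-glue ports (relabel-removed-edges x) ⟨
    R₂₁.lift² (glue A₂₁ (relabel-removed-edges x))                    ∎)
    where open ≡-Reasoning

data Kind : Set where
  vertex boundary : Kind

partition : Kind → (P : Packaged) → Atom (arr P) → Atom (arr P) → Set
partition vertex   = 𝒱
partition boundary = ℬ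

crossing : Kind → Port
crossing vertex   = 1F
crossing boundary = 3F

Same : Kind → (A : ArrowPres) → Atom A → Atom A → Set
Same k A = EqClosure (Adj A (crossing k))

-- p₁, q₁ lie on the incident vertices u, v; p₁, p₂ on the incident boundary components a, b.
incidentPort : Kind → Port
incidentPort vertex   = 2F
incidentPort boundary = 1F

Incident : Kind → (A : ArrowPres) → Edge A → Pred (Atom A) 0ℓ
Incident k A e c = AtPort A e 0F c ⊎ AtPort A e (incidentPort k) c

merges : Op → Kind → Bool
merges ∖op  vertex   = false
merges ∖op  boundary = true
merges ∖mop _        = true
merges /op  vertex   = true
merges /op  boundary = false
merges /mop _        = true
merges †op  _        = true

-- An operation that does not merge blocks of a partition reconnects the circles across e the way
-- the walks along the components of that kind cross e.
crossing-or-merges : ∀ o k → opPort o ≡ crossing k ⊎ merges o k ≡ true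
crossing-or-merges ∖op  vertex   = inj₁ refl
crossing-or-merges ∖op  boundary = inj₂ refl
crossing-or-merges ∖mop _        = inj₂ refl
crossing-or-merges /op  vertex   = inj₂ refl
crossing-or-merges /op  boundary = inj₁ refl
crossing-or-merges /mop _        = inj₂ refl
crossing-or-merges †op  _        = inj₂ refl

Incident-removeEdge⁺ : ∀ A → PortsOnAtoms A → ∀ k e m g′ → Incident k (removeEdge A e m) g′ ⊆ Incident k A (elt g′)
Incident-removeEdge⁺ A ports k e m g′ = Sum.map (AtPort-removeEdge⁺ A e m ports) (AtPort-removeEdge⁺ A e m ports)

Incident-removeEdge⁻ : ∀ A → PortsOnAtoms A → ∀ k e m g′ → Incident k A (elt g′) ⊆ Incident k (removeEdge A e m) g′
Incident-removeEdge⁻ A ports k e m g′ = Sum.map (AtPort-removeEdge⁻ A e m ports) (AtPort-removeEdge⁻ A e m ports)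

module _ {P : Packaged} (wfP : WellFormedP P) where
  private
    A = arr P
    open WellFormedP wfP
    open WellFormed wf

  partition-isEquivalence : ∀ k → IsEquivalence (partition k P)
  partition-isEquivalence vertex   = 𝒱-eq
  partition-isEquivalence boundary = ℬ-eq

  partition-coarsens : ∀ k → Same k A ⇒ partition k P
  partition-coarsens vertex   = 𝒱-part
  partition-coarsens boundary = ℬ-part

  glue-sym : ∀ {x y} → glue A x ≡ y → glue A y ≡ x
  glue-sym {x} refl = glue-invol x

  step-across : ∀ k e {j d} → AtPort A e j d → Σ (Atom A) λ d′ → AtPort A e (j ⊕ crossing k) d′ × partition k P d d′
  step-across k e {j} (b , at) with glue-arc e (j ⊕ crossing k)
  ... | (d′ , b′) , at′ = d′ , (b′ , at′) , partition-coarsens k (return (b , b′ , inj₂ (e , j , glue-sym at , at′)))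

  meets-Incident : ∀ k e j {d} → AtPort A e j d → Meets (partition k P) (Incident k A e) d
  meets-Incident vertex   e 0F {d} at = d , inj₁ at , IsEquivalence.refl 𝒱-eq
  meets-Incident vertex   e 2F {d} at = d , inj₂ at , IsEquivalence.refl 𝒱-eq
  meets-Incident vertex   e 1F at = let d′ , at′ , r = step-across vertex e at in d′ , inj₁ at′ , r
  meets-Incident vertex   e 3F at = let d′ , at′ , r = step-across vertex e at in d′ , inj₂ at′ , r
  meets-Incident boundary e 0F {d} at = d , inj₁ at , IsEquivalence.refl ℬ-eq
  meets-Incident boundary e 1F {d} at = d , inj₂ at , IsEquivalence.refl ℬ-eq
  meets-Incident boundary e 2F at = let d′ , at′ , r = step-across boundary e at in d′ , inj₂ at′ , r
  meets-Incident boundary e 3F at = let d′ , at′ , r = step-across boundary e at in d′ , inj₁ at′ , r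

module _ (P : Packaged) (e : Edge (arr P)) where
  private
    A = arr P

  InBlockAt⊎⇒Meets : ∀ R i j → (λ x → InBlockAt P e R i x ⊎ InBlockAt P e R j x) ⊆ Meets R (λ c → AtPort A e i c ⊎ AtPort A e j c)
  InBlockAt⊎⇒Meets R i j (inj₁ (c , at , r)) = c , inj₁ at , r
  InBlockAt⊎⇒Meets R i j (inj₂ (c , at , r)) = c , inj₂ at , r

  Meets⇒InBlockAt⊎ : ∀ R i j → Meets R (λ c → AtPort A e i c ⊎ AtPort A e j c) ⊆ (λ x → InBlockAt P e R i x ⊎ InBlockAt P e R j x)
  Meets⇒InBlockAt⊎ R i j (c , inj₁ at , r) = inj₁ (c , at , r)
  Meets⇒InBlockAt⊎ R i j (c , inj₂ at , r) = inj₂ (c , at , r)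

  -- The last two summands are the created vertices T (boundary components S).
  created⇒Meets : ∀ R {R₀} i j → R₀ ⇒ R →
    (λ x → InBlockAt P e R i x ⊎ InBlockAt P e R j x ⊎ InBlockAt P e R₀ i x ⊎ InBlockAt P e R₀ j x)
      ⊆ Meets R (λ c → AtPort A e i c ⊎ AtPort A e j c)
  created⇒Meets R i j R₀⇒R (inj₁ b)                       = InBlockAt⊎⇒Meets R i j (inj₁ b)
  created⇒Meets R i j R₀⇒R (inj₂ (inj₁ b))                = InBlockAt⊎⇒Meets R i j (inj₂ b)
  created⇒Meets R i j R₀⇒R (inj₂ (inj₂ (inj₁ (c , at , r)))) = c , inj₁ at , R₀⇒R r
  created⇒Meets R i j R₀⇒R (inj₂ (inj₂ (inj₂ (c , at , r)))) = c , inj₂ at , R₀⇒R r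

  Meets⇒created : ∀ R R₀ i j → Meets R (λ c → AtPort A e i c ⊎ AtPort A e j c)
    ⊆ (λ x → InBlockAt P e R i x ⊎ InBlockAt P e R j x ⊎ InBlockAt P e R₀ i x ⊎ InBlockAt P e R₀ j x)
  Meets⇒created R R₀ i j (c , inj₁ at , r) = inj₁ (c , at , r)
  Meets⇒created R R₀ i j (c , inj₂ at , r) = inj₂ (inj₁ (c , at , r))

  ⟪⟫-partition⇒ : ∀ o k → Same k A ⇒ partition k P → partition k (P ⟪ o ⟫ e) ⇒ mergeIf (merges o k) (partition k P) (Incident k A e)
  ⟪⟫-partition⇒ ∖op  vertex   _    r = r
  ⟪⟫-partition⇒ ∖mop vertex   _      = merge-mono (𝒱 P) (InBlockAt⊎⇒Meets (𝒱 P) 0F 2F)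
  ⟪⟫-partition⇒ /op  vertex   same⇒ = merge-mono (𝒱 P) (created⇒Meets (𝒱 P) 0F 2F same⇒)
  ⟪⟫-partition⇒ /mop vertex   same⇒ = merge-mono (𝒱 P) (created⇒Meets (𝒱 P) 0F 2F same⇒)
  ⟪⟫-partition⇒ †op  vertex   same⇒ = merge-mono (𝒱 P) (created⇒Meets (𝒱 P) 0F 2F same⇒)
  ⟪⟫-partition⇒ ∖op  boundary same⇒ = merge-mono (ℬ P) (created⇒Meets (ℬ P) 0F 1F same⇒)
  ⟪⟫-partition⇒ ∖mop boundary same⇒ = merge-mono (ℬ P) (created⇒Meets (ℬ P) 0F 1F same⇒)
  ⟪⟫-partition⇒ /op  boundary _    r = r
  ⟪⟫-partition⇒ /mop boundary _      = merge-mono (ℬ P) (InBlockAt⊎⇒Meets (ℬ P) 0F 1F)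
  ⟪⟫-partition⇒ †op  boundary same⇒ = merge-mono (ℬ P) (created⇒Meets (ℬ P) 0F 1F same⇒)

  ⟪⟫-partition⇐ : ∀ o k → mergeIf (merges o k) (partition k P) (Incident k A e) ⇒ partition k (P ⟪ o ⟫ e)
  ⟪⟫-partition⇐ ∖op  vertex   r = r
  ⟪⟫-partition⇐ ∖mop vertex     = merge-mono (𝒱 P) (Meets⇒InBlockAt⊎ (𝒱 P) 0F 2F)
  ⟪⟫-partition⇐ /op  vertex     = merge-mono (𝒱 P) (Meets⇒created (𝒱 P) (VRel A) 0F 2F)
  ⟪⟫-partition⇐ /mop vertex     = merge-mono (𝒱 P) (Meets⇒created (𝒱 P) (VRel A) 0F 2F)
  ⟪⟫-partition⇐ †op  vertex     = merge-mono (𝒱 P) (Meets⇒created (𝒱 P) (VRel A) 0F 2F)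
  ⟪⟫-partition⇐ ∖op  boundary   = merge-mono (ℬ P) (Meets⇒created (ℬ P) (BRel A) 0F 1F)
  ⟪⟫-partition⇐ ∖mop boundary   = merge-mono (ℬ P) (Meets⇒created (ℬ P) (BRel A) 0F 1F)
  ⟪⟫-partition⇐ /op  boundary r = r
  ⟪⟫-partition⇐ /mop boundary   = merge-mono (ℬ P) (Meets⇒InBlockAt⊎ (ℬ P) 0F 1F)
  ⟪⟫-partition⇐ †op  boundary   = merge-mono (ℬ P) (Meets⇒created (ℬ P) (BRel A) 0F 1F)

module _ {P : Packaged} (wfP : WellFormedP P) where
  private
    A = arr P
    open WellFormedP wfP
    open WellFormed wf

  ⟪⟫-partition-coarsens : ∀ o k e → Same k (arr (P ⟪ o ⟫ e)) ⇒ partition k (P ⟪ o ⟫ e)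
  ⟪⟫-partition-coarsens o k e =
    ⟪⟫-partition⇐ P e o k ∘ fold (mergeIf-isEquivalence (merges o k) (partition-isEquivalence wfP k)) step
    where
    step : Adj (arr (P ⟪ o ⟫ e)) (crossing k) ⇒ mergeIf (merges o k) (partition k P) (Incident k A e)
    step adj with Adj-removeEdge A e (opPort o) glue-arc adj
    ... | inj₁ adj′ = mergeIf-⊇ (merges o k) (partition-coarsens wfP k (return adj′))
    ... | inj₂ across@(b , b′ , i , into , out) with crossing-or-merges o k
    ...   | inj₁ o≡k =
      mergeIf-⊇ (merges o k) (partition-coarsens wfP k (return (AdjAcross⇒Adj {A} (subst (λ m → AdjAcross A e m _ _) o≡k across))))
    ...   | inj₂ merged =
      mergeIf-merges merged (meets-Incident wfP k e i (b , glue-sym wfP into)) (meets-Incident wfP k e (i ⊕ opPort o) (b′ , out))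

  ⟪⟫-comm-partition : ∀ k {e g} (e≢g : e ≢ g) o₁ o₂
    → partition k ((P ⟪ o₁ ⟫ e) ⟪ o₂ ⟫ rem g (≢-sym e≢g)) ⇒ partition k ((P ⟪ o₂ ⟫ g) ⟪ o₁ ⟫ rem e e≢g)
  ⟪⟫-comm-partition k {e} {g} e≢g o₁ o₂ =
      ⟪⟫-partition⇐ (P ⟪ o₂ ⟫ g) (rem e e≢g) o₁ k
    ∘ mergeIf-mono (merges o₁ k) (⟪⟫-partition⇐ P g o₂ k) (Incident-removeEdge⁻ A glue-arc k g (opPort o₂) (rem e e≢g))
    ∘ mergeIf-comm (partition-isEquivalence wfP k) (merges o₁ k) (merges o₂ k)
    ∘ mergeIf-mono (merges o₂ k) (⟪⟫-partition⇒ P e o₁ k (partition-coarsens wfP k))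
                   (Incident-removeEdge⁺ A glue-arc k e (opPort o₁) (rem g (≢-sym e≢g)))
    ∘ ⟪⟫-partition⇒ (P ⟪ o₁ ⟫ e) (rem g (≢-sym e≢g)) o₂ k (⟪⟫-partition-coarsens o₁ k e)

lemma2p9 : (P : Packaged) → WellFormedP P → (e g : Edge (arr P)) → (e≢g : e ≢ g) → (o₁ o₂ : Op)
    → ((P ⟪ o₁ ⟫ e) ⟪ o₂ ⟫ rem g (λ g≡e → e≢g (sym g≡e))) ≅ ((P ⟪ o₂ ⟫ g) ⟪ o₁ ⟫ rem e e≢g)
lemma2p9 P wfP e g e≢g o₁ o₂ = record
  { atomIso   = ↔-id (Atom (arr P))
  ; edgeIso   = swap-removed-edges (arr P) e≢g (opPort o₁) (opPort o₂)
  ; atomFlip  = λ _ → false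
  ; edgeTwist = λ _ → 0F
  ; glue-comm = removeEdge-comm (arr P) e≢g (opPort o₁) (opPort o₂) (WellFormed.glue-arc (WellFormedP.wf wfP))
  ; 𝒱-pres    = λ _ _ → mk⇔ (⟪⟫-comm-partition wfP vertex e≢g o₁ o₂) (⟪⟫-comm-partition wfP vertex (≢-sym e≢g) o₂ o₁)
  ; ℬ-pres    = λ _ _ → mk⇔ (⟪⟫-comm-partition wfP boundary e≢g o₁ o₂) (⟪⟫-comm-partition wfP boundary (≢-sym e≢g) o₂ o₁)
  }
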